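{- For every positive integer $n$, \[ \sum_{3\le k\le 2n}(-1)^{k-1}\sum_{1\le t\le \lfloor k/2\rfloor}C(n,t)\,C(n-t,k-2t)\,2^{k-2t+1}=2\big((-1)^n+n\big), \] where the left-hand side is interpreted as $0$ when $n=1$.
   Context: $C(m,k)=\frac{m!}{k!(m-k)!}$ for $0\le k\le m$, and $C(m,k)=0$ if $k>m$. -}

module Defs where

open import Data.Nat using (ℕ; zero; suc; _+_; _∸_)
open import Data.Integer using (ℤ; 0ℤ) renaming (_+_ to _+ℤ_)

sumFromTo : ℕ → ℕ → (ℕ → ℤ) → ℤ
sumFromTo a b f = go (suc b ∸ a)
  where
  go : ℕ → ℤ
  go zero    = 0ℤ
  go (suc m) = f (a + m) +ℤ go m

-- Add the omitted rows k ≤ 2 back and exchange the order of summation.  With k = 2t + j, the column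
-- of a fixed t ≥ 1 has alternating signs (−1)^(j+1), so it sums to −2 C(n,t) Σⱼ C(n−t,j) (−2)^j
-- = −2 C(n,t) (−1)^(n−t) by the binomial theorem, and a second use of the binomial theorem
-- (Σ_{t≥1} C(n,t) (−1)^t = −1) makes the full double sum 2(−1)^n.  The omitted rows contribute
-- only the term k = 2, t = 1, which is −2n.
module Submission where

open import Defs
open import Data.Nat using (ℕ; suc; _∸_; _/_; _^_)
open import Data.Nat.Combinatorics using (_C_)
open import Data.Integer using (ℤ; +_; _*_; _+_; -1ℤ) renaming (_^_ to _^ℤ_)
open import Relation.Binary.PropositionalEquality using (_≡_)

open import Data.Nat as ℕ using (zero; _<_; _≤_; _<?_; s≤s)
import Data.Nat.Properties as ℕ
open import Data.Nat.DivMod using (/-monoˡ-≤; m*n/n≡m; m/n*n≤m)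
open import Data.Nat.Combinatorics using (nCk+nC[k+1]≡[n+1]C[k+1]; k>n⇒nCk≡0; nC1≡n)
open import Data.Nat.Tactic.RingSolver using () renaming (solve-∀ to ℕ-solve-∀)
open import Data.Integer using (0ℤ; 1ℤ; -_)
open import Data.Integer.Properties
  using ( +-identityˡ; +-identityʳ; *-identityˡ; *-identityʳ; *-assoc; *-comm; *-zeroʳ
        ; *-distribˡ-+; -1*i≡-i; pos-+; pos-*; ^-zeroˡ; ^-*-assoc; ^-distribˡ-+-*)
open import Data.Integer.Tactic.RingSolver using (solve-∀)
open import Relation.Binary.PropositionalEquality using (refl; sym; trans; cong; cong₂; subst; module ≡-Reasoning)
open import Relation.Nullary using (yes; no; ¬_)
open import Relation.Nullary.Negation using (contradiction)

∑< : ℕ → (ℕ → ℤ) → ℤ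
∑< zero    f = 0ℤ
∑< (suc N) f = f N + ∑< N f

syntax ∑< N (λ i → e) = ∑[ i < N ] e

∑-cong : ∀ N {f g : ℕ → ℤ} → (∀ i → i < N → f i ≡ g i) → ∑< N f ≡ ∑< N g
∑-cong zero    f≗g = refl
∑-cong (suc N) f≗g = cong₂ _+_ (f≗g N (ℕ.n<1+n N)) (∑-cong N (λ i i<N → f≗g i (ℕ.m<n⇒m<1+n i<N)))

∑-zero : ∀ N {f : ℕ → ℤ} → (∀ i → i < N → f i ≡ 0ℤ) → ∑< N f ≡ 0ℤ
∑-zero zero    f≗0 = refl
∑-zero (suc N) f≗0 = trans (cong₂ _+_ (f≗0 N (ℕ.n<1+n N)) (∑-zero N (λ i i<N → f≗0 i (ℕ.m<n⇒m<1+n i<N))))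
                           (+-identityˡ 0ℤ)

∑-distrib-+ : ∀ N (f g : ℕ → ℤ) → ∑[ i < N ] (f i + g i) ≡ ∑< N f + ∑< N g
∑-distrib-+ zero    f g = refl
∑-distrib-+ (suc N) f g = trans (cong (λ s → (f N + g N) + s) (∑-distrib-+ N f g)) (interchange (f N) (g N) (∑< N f) (∑< N g))
  where
  interchange : ∀ a b c d → (a + b) + (c + d) ≡ (a + c) + (b + d)
  interchange = solve-∀

*-distribˡ-∑ : ∀ N c (f : ℕ → ℤ) → c * ∑< N f ≡ ∑[ i < N ] (c * f i)
*-distribˡ-∑ zero    c f = *-zeroʳ c
*-distribˡ-∑ (suc N) c f = trans (*-distribˡ-+ c (f N) (∑< N f)) (cong (λ s → c * f N + s) (*-distribˡ-∑ N c f))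

∑-comm : ∀ M N (f : ℕ → ℕ → ℤ) → ∑[ i < M ] ∑[ j < N ] f i j ≡ ∑[ j < N ] ∑[ i < M ] f i j
∑-comm zero    N f = sym (∑-zero N (λ _ _ → refl))
∑-comm (suc M) N f = trans (cong (λ s → ∑< N (f M) + s) (∑-comm M N f)) (sym (∑-distrib-+ N (f M) (λ j → ∑[ i < M ] f i j)))

∑-split : ∀ b a (f : ℕ → ℤ) → ∑< (b ℕ.+ a) f ≡ ∑[ i < b ] f (a ℕ.+ i) + ∑< a f
∑-split zero    a f = sym (+-identityˡ _)
∑-split (suc b) a f = trans (cong₂ _+_ (cong f (ℕ.+-comm b a)) (∑-split b a f)) (assoc (f (a ℕ.+ b)) _ _)
  where
  assoc : ∀ x y z → x + (y + z) ≡ (x + y) + z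
  assoc = solve-∀

∑-suc : ∀ N (f : ℕ → ℤ) → ∑< (suc N) f ≡ ∑[ i < N ] f (suc i) + f 0
∑-suc N f = trans (cong (λ K → ∑< K f) (ℕ.+-comm 1 N)) (trans (∑-split N 1 f) (cong (λ s → ∑[ i < N ] f (suc i) + s) (+-identityʳ (f 0))))

∑-vanishing-below : ∀ c d (f : ℕ → ℤ) → (∀ i → i < c → f i ≡ 0ℤ) → ∑< (d ℕ.+ c) f ≡ ∑[ j < d ] f (c ℕ.+ j)
∑-vanishing-below c d f f≗0 = trans (∑-split d c f) (trans (cong (λ s → ∑[ j < d ] f (c ℕ.+ j) + s) (∑-zero c f≗0)) (+-identityʳ _))

∑-vanishing-above : ∀ {M N} (f : ℕ → ℤ) → (∀ i → M ≤ i → f i ≡ 0ℤ) → M ≤ N → ∑< N f ≡ ∑< M f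
∑-vanishing-above {M} {N} f f≗0 M≤N = begin
  ∑< N f                                   ≡⟨ cong (λ K → ∑< K f) (sym (ℕ.m∸n+n≡m M≤N)) ⟩
  ∑< (N ∸ M ℕ.+ M) f                       ≡⟨ ∑-split (N ∸ M) M f ⟩
  ∑[ i < N ∸ M ] f (M ℕ.+ i) + ∑< M f      ≡⟨ cong (_+ ∑< M f) (∑-zero (N ∸ M) (λ i _ → f≗0 (M ℕ.+ i) (ℕ.m≤m+n M i))) ⟩
  0ℤ + ∑< M f                              ≡⟨ +-identityˡ _ ⟩
  ∑< M f                                   ∎
  where open ≡-Reasoning

truncate : ℕ → (ℕ → ℤ) → ℕ → ℤ
truncate M f i with i <? M
... | yes _ = f i
... | no  _ = 0ℤ

truncate-< : ∀ {M i} (f : ℕ → ℤ) → i < M → truncate M f i ≡ f i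
truncate-< {M} {i} f i<M with i <? M
... | yes _   = refl
... | no  i≮M = contradiction i<M i≮M

truncate-≮ : ∀ {M i} (f : ℕ → ℤ) → ¬ i < M → truncate M f i ≡ 0ℤ
truncate-≮ {M} {i} f i≮M with i <? M
... | yes i<M = contradiction i<M i≮M
... | no  _   = refl

∑-truncate : ∀ {M N} (f : ℕ → ℤ) → M ≤ N → ∑< N (truncate M f) ≡ ∑< M f
∑-truncate {M} f M≤N =
  trans (∑-vanishing-above (truncate M f) (λ i M≤i → truncate-≮ f (ℕ.≤⇒≯ M≤i)) M≤N)
        (∑-cong M (λ i i<M → truncate-< f i<M))

sumFromTo-1 : ∀ b f → sumFromTo 1 b f ≡ ∑[ i < b ] f (suc i)
sumFromTo-1 zero    f = refl
sumFromTo-1 (suc b) f = cong (λ s → f (suc b) + s) (sumFromTo-1 b f)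

sumFromTo-3 : ∀ d f → sumFromTo 3 (2 ℕ.+ d) f + ∑< 3 f ≡ ∑< (3 ℕ.+ d) f
sumFromTo-3 zero    f = +-identityˡ _
sumFromTo-3 (suc d) f = trans (assoc (f (3 ℕ.+ d)) _ _) (cong (λ s → f (3 ℕ.+ d) + s) (sumFromTo-3 d f))
  where
  assoc : ∀ x y z → (x + y) + z ≡ x + (y + z)
  assoc = solve-∀

binomial : ∀ x m → ∑[ j < suc m ] (+ (m C j) * x ^ℤ j) ≡ (1ℤ + x) ^ℤ m
binomial x zero    = refl
binomial x (suc m) = begin
  ∑[ j < suc (suc m) ] B′ j                          ≡⟨ ∑-suc (suc m) B′ ⟩
  ∑[ j < suc m ] B′ (suc j) + 1ℤ                     ≡⟨ cong (_+ 1ℤ) (∑-cong (suc m) (λ j _ → pascal j)) ⟩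
  ∑[ j < suc m ] (x * B j + B (suc j)) + 1ℤ          ≡⟨ cong (_+ 1ℤ) (∑-distrib-+ (suc m) (λ j → x * B j) (λ j → B (suc j))) ⟩
  (∑[ j < suc m ] (x * B j) + ∑[ j < suc m ] B (suc j)) + 1ℤ
                                                    ≡⟨ regroup (∑[ j < suc m ] (x * B j)) _ 1ℤ ⟩
  ∑[ j < suc m ] (x * B j) + (∑[ j < suc m ] B (suc j) + B 0)
                                                    ≡⟨ cong₂ _+_ (sym (*-distribˡ-∑ (suc m) x B)) (sym (∑-suc (suc m) B)) ⟩
  x * ∑< (suc m) B + (B (suc m) + ∑< (suc m) B)      ≡⟨ cong (λ b → x * ∑< (suc m) B + (b + ∑< (suc m) B)) top-vanishes ⟩
  x * ∑< (suc m) B + (0ℤ + ∑< (suc m) B)             ≡⟨ cong (λ s → x * s + (0ℤ + s)) (binomial x m) ⟩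
  x * P + (0ℤ + P)                                   ≡⟨ factor x P ⟩
  (1ℤ + x) ^ℤ suc m                                  ∎
  where
  open ≡-Reasoning
  B B′ : ℕ → ℤ
  B  j = + (m C j) * x ^ℤ j
  B′ j = + (suc m C j) * x ^ℤ j
  P = (1ℤ + x) ^ℤ m

  regroup : ∀ a b c → (a + b) + c ≡ a + (b + c)
  regroup = solve-∀
  factor : ∀ x P → x * P + (0ℤ + P) ≡ (1ℤ + x) * P
  factor = solve-∀
  split-power : ∀ a b x y → (a + b) * (x * y) ≡ x * (a * y) + b * (x * y)
  split-power = solve-∀

  top-vanishes : B (suc m) ≡ 0ℤ
  top-vanishes = cong (λ c → + c * x ^ℤ suc m) (k>n⇒nCk≡0 (ℕ.n<1+n m))

  pascal : ∀ j → B′ (suc j) ≡ x * B j + B (suc j)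
  pascal j = begin
    + (suc m C suc j) * (x * x ^ℤ j)                 ≡⟨ cong (λ c → + c * (x * x ^ℤ j)) (sym (nCk+nC[k+1]≡[n+1]C[k+1] m j)) ⟩
    + (m C j ℕ.+ m C suc j) * (x * x ^ℤ j)           ≡⟨ cong (_* (x * x ^ℤ j)) (pos-+ (m C j) (m C suc j)) ⟩
    (+ (m C j) + + (m C suc j)) * (x * x ^ℤ j)       ≡⟨ split-power (+ (m C j)) (+ (m C suc j)) x (x ^ℤ j) ⟩
    x * B j + B (suc j)                              ∎

-1^[2a]≡1 : ∀ a → -1ℤ ^ℤ (2 ℕ.* a) ≡ 1ℤ
-1^[2a]≡1 a = trans (sym (^-*-assoc -1ℤ 2 a)) (^-zeroˡ a)

-1^[2a+b] : ∀ a b → -1ℤ ^ℤ (2 ℕ.* a ℕ.+ b) ≡ -1ℤ ^ℤ b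
-1^[2a+b] a b = begin
  -1ℤ ^ℤ (2 ℕ.* a ℕ.+ b)             ≡⟨ ^-distribˡ-+-* -1ℤ (2 ℕ.* a) b ⟩
  -1ℤ ^ℤ (2 ℕ.* a) * -1ℤ ^ℤ b        ≡⟨ cong (_* -1ℤ ^ℤ b) (-1^[2a]≡1 a) ⟩
  1ℤ * -1ℤ ^ℤ b                      ≡⟨ *-identityˡ _ ⟩
  -1ℤ ^ℤ b                           ∎
  where open ≡-Reasoning

-1^[m∸n] : ∀ {m n} → n ≤ m → -1ℤ ^ℤ (m ∸ n) ≡ -1ℤ ^ℤ m * -1ℤ ^ℤ n
-1^[m∸n] {m} {n} n≤m = sym (begin
  -1ℤ ^ℤ m * -1ℤ ^ℤ n                        ≡⟨ cong (λ k → -1ℤ ^ℤ k * -1ℤ ^ℤ n) (sym (ℕ.m∸n+n≡m n≤m)) ⟩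
  -1ℤ ^ℤ (m ∸ n ℕ.+ n) * -1ℤ ^ℤ n            ≡⟨ cong (_* -1ℤ ^ℤ n) (^-distribˡ-+-* -1ℤ (m ∸ n) n) ⟩
  (-1ℤ ^ℤ (m ∸ n) * -1ℤ ^ℤ n) * -1ℤ ^ℤ n     ≡⟨ *-assoc (-1ℤ ^ℤ (m ∸ n)) _ _ ⟩
  -1ℤ ^ℤ (m ∸ n) * (-1ℤ ^ℤ n * -1ℤ ^ℤ n)     ≡⟨ cong (-1ℤ ^ℤ (m ∸ n) *_) (sym (^-distribˡ-+-* -1ℤ n n)) ⟩
  -1ℤ ^ℤ (m ∸ n) * -1ℤ ^ℤ (n ℕ.+ n)          ≡⟨ cong (λ k → -1ℤ ^ℤ (m ∸ n) * -1ℤ ^ℤ (n ℕ.+ k)) (sym (ℕ.+-identityʳ n)) ⟩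
  -1ℤ ^ℤ (m ∸ n) * -1ℤ ^ℤ (2 ℕ.* n)          ≡⟨ cong (-1ℤ ^ℤ (m ∸ n) *_) (-1^[2a]≡1 n) ⟩
  -1ℤ ^ℤ (m ∸ n) * 1ℤ                        ≡⟨ *-identityʳ _ ⟩
  -1ℤ ^ℤ (m ∸ n)                             ∎)
  where open ≡-Reasoning

-1^a*2^a : ∀ a → -1ℤ ^ℤ a * + (2 ^ a) ≡ (- + 2) ^ℤ a
-1^a*2^a zero    = refl
-1^a*2^a (suc a) = begin
  (-1ℤ * -1ℤ ^ℤ a) * + (2 ℕ.* 2 ^ a)          ≡⟨ cong ((-1ℤ * -1ℤ ^ℤ a) *_) (pos-* 2 (2 ^ a)) ⟩
  (-1ℤ * -1ℤ ^ℤ a) * (+ 2 * + (2 ^ a))        ≡⟨ regroup (-1ℤ ^ℤ a) (+ (2 ^ a)) ⟩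
  - + 2 * (-1ℤ ^ℤ a * + (2 ^ a))              ≡⟨ cong (- + 2 *_) (-1^a*2^a a) ⟩
  - + 2 * (- + 2) ^ℤ a                        ∎
  where
  open ≡-Reasoning
  regroup : ∀ s p → (-1ℤ * s) * (+ 2 * p) ≡ - + 2 * (s * p)
  regroup = solve-∀

m*n≤o⇒m≤o/n : ∀ {m n o} .{{_ : ℕ.NonZero n}} → m ℕ.* n ≤ o → m ≤ o / n
m*n≤o⇒m≤o/n {m} {n} m*n≤o = subst (_≤ _ / n) (m*n/n≡m m n) (/-monoˡ-≤ n m*n≤o)

m≤o/n⇒m*n≤o : ∀ {m n o} .{{_ : ℕ.NonZero n}} → m ≤ o / n → m ℕ.* n ≤ o
m≤o/n⇒m*n≤o {m} {n} {o} m≤o/n = ℕ.≤-trans (ℕ.*-monoˡ-≤ n m≤o/n) (m/n*n≤m o n)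

∑-C[n,1+i]*-1^[n∸1+i] : ∀ m → let n = suc m in
  ∑[ i < n ] (+ (n C suc i) * -1ℤ ^ℤ (n ∸ suc i)) ≡ - (-1ℤ ^ℤ n)
∑-C[n,1+i]*-1^[n∸1+i] m = begin
  ∑[ i < n ] (+ (n C suc i) * -1ℤ ^ℤ (n ∸ suc i))     ≡⟨ ∑-cong n (λ i 1+i≤n → trans (cong (+ (n C suc i) *_) (-1^[m∸n] 1+i≤n))
                                                                                  (swap (+ (n C suc i)) (-1ℤ ^ℤ n) _)) ⟩
  ∑[ i < n ] (-1ℤ ^ℤ n * B (suc i))                    ≡⟨ sym (*-distribˡ-∑ n (-1ℤ ^ℤ n) (λ i → B (suc i))) ⟩
  -1ℤ ^ℤ n * ∑[ i < n ] B (suc i)                      ≡⟨ cong (-1ℤ ^ℤ n *_) (solve-for-∑ (∑[ i < n ] B (suc i)) (trans (sym (∑-suc n B)) (binomial -1ℤ n))) ⟩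
  -1ℤ ^ℤ n * -1ℤ                                       ≡⟨ *-comm (-1ℤ ^ℤ n) -1ℤ ⟩
  -1ℤ * -1ℤ ^ℤ n                                       ≡⟨ -1*i≡-i (-1ℤ ^ℤ n) ⟩
  - (-1ℤ ^ℤ n)                                         ∎
  where
  open ≡-Reasoning
  n = suc m
  B : ℕ → ℤ
  B j = + (n C j) * -1ℤ ^ℤ j
  swap : ∀ c s t → c * (s * t) ≡ s * (c * t)
  swap = solve-∀
  -- binomial -1ℤ n ends in (1ℤ + -1ℤ) ^ℤ suc m, which computes to 0ℤ.
  solve-for-∑ : ∀ S → S + 1ℤ ≡ 0ℤ → S ≡ -1ℤ
  solve-for-∑ S S+1≡0 = trans (add-1 S) (cong (_+ -1ℤ) S+1≡0)
    where
    add-1 : ∀ S → S ≡ (S + 1ℤ) + -1ℤ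
    add-1 = solve-∀

sign : ℕ → ℤ
sign k = -1ℤ ^ℤ (k ∸ 1)

summand : ℕ → ℕ → ℕ → ℤ
summand n k t = + ((n C t) ℕ.* ((n ∸ t) C (k ∸ 2 ℕ.* t)) ℕ.* 2 ^ (k ∸ 2 ℕ.* t ℕ.+ 1))

row : ℕ → ℕ → ℤ
row n k = sign k * sumFromTo 1 (k / 2) (summand n k)

entry : ℕ → ℕ → ℕ → ℤ
entry n k i = sign k * truncate (k / 2) (λ t → summand n k (suc t)) i

row≡∑-entry : ∀ {n k} → k ≤ 2 ℕ.* n → row n k ≡ ∑[ i < n ] entry n k i
row≡∑-entry {n} {k} k≤2n = begin
  sign k * sumFromTo 1 (k / 2) (summand n k)                       ≡⟨ cong (sign k *_) (sumFromTo-1 (k / 2) (summand n k)) ⟩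
  sign k * ∑[ i < k / 2 ] summand n k (suc i)                      ≡⟨ cong (sign k *_) (sym (∑-truncate (λ t → summand n k (suc t)) k/2≤n)) ⟩
  sign k * ∑< n (truncate (k / 2) (λ t → summand n k (suc t)))     ≡⟨ *-distribˡ-∑ n (sign k) _ ⟩
  ∑[ i < n ] entry n k i                                           ∎
  where
  open ≡-Reasoning
  k/2≤n : k / 2 ≤ n
  k/2≤n = subst (k / 2 ≤_) (m*n/n≡m n 2) (/-monoˡ-≤ 2 (subst (k ≤_) (ℕ.*-comm 2 n) k≤2n))

entry-below : ∀ {n k i} → k < 2 ℕ.* suc i → entry n k i ≡ 0ℤ
entry-below {n} {k} {i} k<2[1+i] = trans (cong (sign k *_) (truncate-≮ _ i≮k/2)) (*-zeroʳ (sign k))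
  where
  i≮k/2 : ¬ i < k / 2
  i≮k/2 i<k/2 = ℕ.<⇒≱ k<2[1+i] (subst (_≤ k) (ℕ.*-comm (suc i) 2) (m≤o/n⇒m*n≤o i<k/2))

entry-diagonal : ∀ n i j → let e = n ∸ suc i in
  entry n (2 ℕ.* suc i ℕ.+ j) i ≡ (- + 2 * + (n C suc i)) * (+ (e C j) * (- + 2) ^ℤ j)
entry-diagonal n i j = begin
  sign k * truncate (k / 2) (λ t → summand n k (suc t)) i      ≡⟨ cong₂ _*_ sign-k (truncate-< _ i<k/2) ⟩
  -1ℤ ^ℤ suc j * summand n k (suc i)                            ≡⟨ cong (λ l → -1ℤ ^ℤ suc j * + (c ℕ.* (e C l) ℕ.* 2 ^ (l ℕ.+ 1))) k∸2[1+i]≡j ⟩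
  -1ℤ ^ℤ suc j * + (c ℕ.* (e C j) ℕ.* 2 ^ (j ℕ.+ 1))            ≡⟨ cong (λ l → -1ℤ ^ℤ suc j * + (c ℕ.* (e C j) ℕ.* 2 ^ l)) (ℕ.+-comm j 1) ⟩
  -1ℤ ^ℤ suc j * + (c ℕ.* (e C j) ℕ.* 2 ^ suc j)                ≡⟨ cong (-1ℤ ^ℤ suc j *_) (trans (pos-* (c ℕ.* (e C j)) _) (cong (_* + (2 ^ suc j)) (pos-* c (e C j)))) ⟩
  -1ℤ ^ℤ suc j * (+ c * + (e C j) * + (2 ^ suc j))              ≡⟨ pull-sign (-1ℤ ^ℤ suc j) (+ c) (+ (e C j)) _ ⟩
  (+ c * + (e C j)) * (-1ℤ ^ℤ suc j * + (2 ^ suc j))            ≡⟨ cong ((+ c * + (e C j)) *_) (-1^a*2^a (suc j)) ⟩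
  (+ c * + (e C j)) * (- + 2 * (- + 2) ^ℤ j)                    ≡⟨ regroup (+ c) (+ (e C j)) _ ⟩
  (- + 2 * + c) * (+ (e C j) * (- + 2) ^ℤ j)                    ∎
  where
  open ≡-Reasoning
  k = 2 ℕ.* suc i ℕ.+ j
  c = n C suc i
  e = n ∸ suc i
  k∸2[1+i]≡j : k ∸ 2 ℕ.* suc i ≡ j
  k∸2[1+i]≡j = ℕ.m+n∸m≡n (2 ℕ.* suc i) j
  i<k/2 : i < k / 2
  i<k/2 = m*n≤o⇒m≤o/n (subst (_≤ k) (ℕ.*-comm 2 (suc i)) (ℕ.m≤m+n (2 ℕ.* suc i) j))
  k∸1≡2i+[1+j] : k ∸ 1 ≡ 2 ℕ.* i ℕ.+ suc j
  k∸1≡2i+[1+j] = cong (_∸ 1) (shuffle i j)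
    where
    shuffle : ∀ i j → 2 ℕ.* suc i ℕ.+ j ≡ suc (2 ℕ.* i ℕ.+ suc j)
    shuffle = ℕ-solve-∀
  sign-k : sign k ≡ -1ℤ ^ℤ suc j
  sign-k = trans (cong (-1ℤ ^ℤ_) k∸1≡2i+[1+j]) (-1^[2a+b] i (suc j))
  pull-sign : ∀ s c b p → s * (c * b * p) ≡ (c * b) * (s * p)
  pull-sign = solve-∀
  regroup : ∀ c b q → (c * b) * (- + 2 * q) ≡ (- + 2 * c) * (b * q)
  regroup = solve-∀

∑-column : ∀ {n i} → i < n → ∑[ k < suc (2 ℕ.* n) ] entry n k i ≡ (- + 2 * + (n C suc i)) * -1ℤ ^ℤ (n ∸ suc i)
∑-column {n} {i} i<n = begin
  ∑< (suc (2 ℕ.* n)) (λ k → entry n k i)                  ≡⟨ cong (λ K → ∑< K (λ k → entry n k i)) length-split ⟩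
  ∑< (suc (2 ℕ.* e) ℕ.+ 2 ℕ.* t) (λ k → entry n k i)      ≡⟨ ∑-vanishing-below (2 ℕ.* t) (suc (2 ℕ.* e)) (λ k → entry n k i) (λ k k<2t → entry-below {n} k<2t) ⟩
  ∑[ j < suc (2 ℕ.* e) ] entry n (2 ℕ.* t ℕ.+ j) i        ≡⟨ ∑-cong (suc (2 ℕ.* e)) (λ j _ → entry-diagonal n i j) ⟩
  ∑[ j < suc (2 ℕ.* e) ] (K * B j)                        ≡⟨ sym (*-distribˡ-∑ (suc (2 ℕ.* e)) K B) ⟩
  K * ∑< (suc (2 ℕ.* e)) B                                ≡⟨ cong (K *_) (∑-vanishing-above B B-vanishes (s≤s (ℕ.m≤n*m e 2))) ⟩
  K * ∑< (suc e) B                                        ≡⟨ cong (K *_) (binomial (- + 2) e) ⟩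
  K * -1ℤ ^ℤ e                                            ∎
  where
  open ≡-Reasoning
  t = suc i
  e = n ∸ t
  K = - + 2 * + (n C t)
  B : ℕ → ℤ
  B j = + (e C j) * (- + 2) ^ℤ j
  B-vanishes : ∀ j → suc e ≤ j → B j ≡ 0ℤ
  B-vanishes j e<j = cong (λ c → + c * (- + 2) ^ℤ j) (k>n⇒nCk≡0 e<j)
  length-split : suc (2 ℕ.* n) ≡ suc (2 ℕ.* e) ℕ.+ 2 ℕ.* t
  length-split = trans (cong (λ m → suc (2 ℕ.* m)) (sym (ℕ.m∸n+n≡m i<n))) (distrib e t)
    where
    distrib : ∀ e t → suc (2 ℕ.* (e ℕ.+ t)) ≡ suc (2 ℕ.* e) ℕ.+ 2 ℕ.* t
    distrib = ℕ-solve-∀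

∑-row : ∀ m → let n = suc m in ∑[ k < suc (2 ℕ.* n) ] row n k ≡ + 2 * -1ℤ ^ℤ n
∑-row m = begin
  ∑[ k < suc (2 ℕ.* n) ] row n k                                     ≡⟨ ∑-cong (suc (2 ℕ.* n)) (λ k k<1+2n → row≡∑-entry (ℕ.≤-pred k<1+2n)) ⟩
  ∑[ k < suc (2 ℕ.* n) ] ∑[ i < n ] entry n k i                      ≡⟨ ∑-comm (suc (2 ℕ.* n)) n (entry n) ⟩
  ∑[ i < n ] ∑[ k < suc (2 ℕ.* n) ] entry n k i                      ≡⟨ ∑-cong n (λ i i<n → trans (∑-column i<n) (*-assoc (- + 2) (+ (n C suc i)) _)) ⟩
  ∑[ i < n ] (- + 2 * (+ (n C suc i) * -1ℤ ^ℤ (n ∸ suc i)))          ≡⟨ sym (*-distribˡ-∑ n (- + 2) (λ i → + (n C suc i) * -1ℤ ^ℤ (n ∸ suc i))) ⟩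
  - + 2 * ∑[ i < n ] (+ (n C suc i) * -1ℤ ^ℤ (n ∸ suc i))            ≡⟨ cong (- + 2 *_) (∑-C[n,1+i]*-1^[n∸1+i] m) ⟩
  - + 2 * - (-1ℤ ^ℤ n)                                               ≡⟨ neg-cancel (-1ℤ ^ℤ n) ⟩
  + 2 * -1ℤ ^ℤ n                                                     ∎
  where
  open ≡-Reasoning
  n = suc m
  neg-cancel : ∀ s → - + 2 * - s ≡ + 2 * s
  neg-cancel = solve-∀

∑-row-head : ∀ n → ∑< 3 (row n) ≡ - + (2 ℕ.* n)
-- By computation: rows 0 and 1 are empty and row 2 is the single term t = 1.
∑-row-head n = begin
  -1ℤ * (+ ((n C 1) ℕ.* 1 ℕ.* 2) + 0ℤ) + (1ℤ * 0ℤ + (1ℤ * 0ℤ + 0ℤ))    ≡⟨ cong (λ c → -1ℤ * (+ (c ℕ.* 1 ℕ.* 2) + 0ℤ) + (1ℤ * 0ℤ + (1ℤ * 0ℤ + 0ℤ))) (nC1≡n n) ⟩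
  -1ℤ * (+ (n ℕ.* 1 ℕ.* 2) + 0ℤ) + (1ℤ * 0ℤ + (1ℤ * 0ℤ + 0ℤ))          ≡⟨ cong (λ c → -1ℤ * (+ c + 0ℤ) + (1ℤ * 0ℤ + (1ℤ * 0ℤ + 0ℤ))) (n*1*2≡2*n n) ⟩
  -1ℤ * (+ (2 ℕ.* n) + 0ℤ) + (1ℤ * 0ℤ + (1ℤ * 0ℤ + 0ℤ))                ≡⟨ simplify (+ (2 ℕ.* n)) ⟩
  - + (2 ℕ.* n)                                                        ∎
  where
  open ≡-Reasoning
  n*1*2≡2*n : ∀ n → n ℕ.* 1 ℕ.* 2 ≡ 2 ℕ.* n
  n*1*2≡2*n = ℕ-solve-∀
  simplify : ∀ x → -1ℤ * (x + 0ℤ) + (1ℤ * 0ℤ + (1ℤ * 0ℤ + 0ℤ)) ≡ - x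
  simplify = solve-∀

mainTheorem7 : ∀ (m : ℕ) → let n = suc m in
    sumFromTo 3 (2 Data.Nat.* n) (λ k → (-1ℤ ^ℤ (k ∸ 1)) *
      sumFromTo 1 (k / 2) (λ t → + ((n C t) Data.Nat.* ((n ∸ t) C (k ∸ 2 Data.Nat.* t)) Data.Nat.* (2 ^ (k ∸ 2 Data.Nat.* t Data.Nat.+ 1)))))
    ≡ + 2 * ((-1ℤ ^ℤ n) + + n)
mainTheorem7 m = begin
  X                                     ≡⟨ solve-for-X X H ⟩
  (X + H) + - H                         ≡⟨ cong₂ (λ a b → a + - b) X+H≡∑-row (∑-row-head n) ⟩
  ∑< (suc (2 ℕ.* n)) (row n) + - - + (2 ℕ.* n)
                                        ≡⟨ cong₂ (λ a b → a + - - b) (∑-row m) (pos-* 2 n) ⟩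
  + 2 * -1ℤ ^ℤ n + - - (+ 2 * + n)      ≡⟨ collect (-1ℤ ^ℤ n) (+ n) ⟩
  + 2 * (-1ℤ ^ℤ n + + n)                ∎
  where
  open ≡-Reasoning
  n = suc m
  X = sumFromTo 3 (2 ℕ.* n) (row n)
  H = ∑< 3 (row n)
  X+H≡∑-row : X + H ≡ ∑< (suc (2 ℕ.* n)) (row n)
  X+H≡∑-row = subst (λ b → sumFromTo 3 b (row n) + H ≡ ∑< (suc b) (row n)) (sym (ℕ.*-suc 2 m)) (sumFromTo-3 (2 ℕ.* m) (row n))
  solve-for-X : ∀ X H → X ≡ (X + H) + - H
  solve-for-X = solve-∀
  collect : ∀ s x → + 2 * s + - - (+ 2 * x) ≡ + 2 * (s + x)
  collect = solve-∀
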